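{- Let $r,m\ge 2$ and let $M[Q]$ be a generalized Catalan matroid of rank $r$ and corank $m$ having neither a loop nor an isthmus. Then for every pair of adjacent bases $B_1,B_2$ of $\operatorname{BG}(M[Q])$, there are at least $\min\{r-1,m-1\}$ distinct good cycles for $B_1B_2$.
   Context: Lattice paths go from $(0,0)$ to $(m,r)$ using steps $E=(1,0)$ and $N=(0,1)$, and are written as words of length $m+r$ over $\{E,N\}$. Given such a path $Q$, the generalized Catalan matroid $M[Q]$ is the matroid on ground set $[m+r]=\{1,\dots,m+r\}$ whose bases are the sets $B=\{j : \text{the $j$th step of } L \text{ is } N\}$ for the lattice paths $L$ from $(0,0)$ to $(m,r)$ that never go above $Q$ (equivalently, for each $i$, the $i$th $N$ step of $L$ occurs at a position no earlier than the $i$th $N$ step of $Q$). It has rank $r$ and corank $m$. For a matroid $M$, its basis graph $\operatorname{BG}(M)$ has the bases of $M$ as vertices, two bases $B,B'$ being adjacent if and only if $|B\triangle B'|=2$. For adjacent bases $B_1,B_2$ with $B_1\setminus B_2=\{e\}$, a good cycle for $B_1B_2$ is a sequence of four distinct bases $B_1B_2B_3B_4$ forming a cycle in $\operatorname{BG}(M)$ (so that $B_2B_3$, $B_3B_4$ and $B_4B_1$ are edges) such that $e\in B_4$ and $e\notin B_3$. -}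

module Defs where

open import Data.Nat using (ℕ; zero; suc; _+_; _≤_)
open import Data.Fin using (Fin)
open import Data.Vec using (Vec; []; _∷_; lookup)
open import Data.Product using (_×_; ∃-syntax)
open import Relation.Binary.PropositionalEquality using (_≡_; _≢_)

data Step : Set where
  E N : Step

-- For a basis word L,
-- position j (a Fin n, i.e. element j+1 of [n]) lies in the basis iff
-- lookup L j ≡ N.
Word : ℕ → Set
Word n = Vec Step n

countN : ∀ {n} → Word n → ℕ
countN [] = 0
countN (E ∷ w) = countN w
countN (N ∷ w) = suc (countN w)

prefN : ∀ {n} → ℕ → Word n → ℕ
prefN zero w = 0
prefN (suc k) [] = 0
prefN (suc k) (E ∷ w) = prefN k w
prefN (suc k) (N ∷ w) = suc (prefN k w)

NeverAbove : ∀ {n} → Word n → Word n → Set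
NeverAbove L Q = ∀ k → prefN k L ≤ prefN k Q

IsPath : (m r : ℕ) → Word (m + r) → Set
IsPath m r Q = countN Q ≡ r

IsBasis : (m r : ℕ) → Word (m + r) → Word (m + r) → Set
IsBasis m r Q B = countN B ≡ r × NeverAbove B Q

diffCount : ∀ {n} → Word n → Word n → ℕ
diffCount [] [] = 0
diffCount (E ∷ u) (E ∷ v) = diffCount u v
diffCount (N ∷ u) (N ∷ v) = diffCount u v
diffCount (E ∷ u) (N ∷ v) = suc (diffCount u v)
diffCount (N ∷ u) (E ∷ v) = suc (diffCount u v)

Adjacent : ∀ {n} → Word n → Word n → Set
Adjacent B B' = diffCount B B' ≡ 2

NoLoop : (m r : ℕ) → Word (m + r) → Set
NoLoop m r Q = ∀ (j : Fin (m + r)) → ∃[ B ] (IsBasis m r Q B × lookup B j ≡ N)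

NoIsthmus : (m r : ℕ) → Word (m + r) → Set
NoIsthmus m r Q = ∀ (j : Fin (m + r)) → ∃[ B ] (IsBasis m r Q B × lookup B j ≡ E)

-- B1 B2 B3 B4 is a good cycle for B1B2, where e is the element of B1 ∖ B2.
GoodCycle : (m r : ℕ) → Word (m + r) → Fin (m + r)
          → (B1 B2 B3 B4 : Word (m + r)) → Set
GoodCycle m r Q e B1 B2 B3 B4 =
  IsBasis m r Q B3 × IsBasis m r Q B4
  × B1 ≢ B3 × B1 ≢ B4 × B2 ≢ B3 × B2 ≢ B4 × B3 ≢ B4
  × Adjacent B2 B3 × Adjacent B3 B4 × Adjacent B4 B1
  × lookup B4 e ≡ N × lookup B3 e ≡ E

-- Write B1 = S ∪ {e} and B2 = S ∪ {f}, so |S| = r − 1, and let T be the m − 1 elements outside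
-- B1 ∪ B2.  Every cycle used has the shape B3 = B2 − a + b, B4 = B1 − c + d with e ∉ {a, b, c, d},
-- and is good as soon as B3 and B4 are bases and B3 B4 is an edge.  The exchange w − x + y of a
-- basis w stays under Q provided w lies strictly below Q at every step between y and x.  That
-- holds on an initial run of E steps of w, since Q starts with N (no loop), and on a final run of
-- N steps of w, since Q has an E step after every position (no isthmus).  Let x₀ = min S and
-- y₀ = max T.  If x₀ precedes e or f, exchanging x₀ (or f) against each y ∈ T gives m − 1 good
-- cycles; otherwise exchanging each x ∈ S against y₀ (or f) gives r − 1.  Cycles built from
-- different indices differ at that index.
module Submission where

open import Defs
open import Data.Nat using (ℕ; zero; suc; _≤_; _<_; _+_; _⊓_; _∸_; z≤n; s≤s; _≤?_; _<?_)
open import Data.Nat.Properties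
  using (≤-refl; ≤-trans; ≤-reflexive; <⇒≤; <-≤-trans; ≤-<-trans; ≮⇒≥; n≤1+n; m≤n⇒m≤1+n;
         +-suc; +-comm; +-monoˡ-≤; +-cancelˡ-≡; +-cancelʳ-<; m+1+n≢0; suc-injective; <-asym; ≰⇒>;
         m+n∸n≡m; m⊓n≤m; m⊓n≤n; m<n⇒0<n∸m; module ≤-Reasoning)
open import Data.Fin using (Fin; zero; suc; toℕ; fromℕ<)
import Data.Fin.Properties as Finₚ
open import Data.Vec using ([]; _∷_; lookup; _[_]≔_)
open import Data.Vec.Properties using (lookup∘update; lookup∘update′)
open import Data.Product using (_×_; _,_; ∃-syntax; proj₁; proj₂; Σ)
open import Data.List using (List; []; _∷_; length; map)
open import Data.List.Properties using (length-map)
open import Data.List.Membership.Propositional using (_∈_)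
open import Data.List.Membership.Propositional.Properties using (∈-map⁺; ∈-map⁻)
open import Data.List.Relation.Unary.Any using (here; there)
open import Data.List.Relation.Unary.All as All using (All; []; _∷_)
import Data.List.Relation.Unary.All.Properties as Allₚ
open import Data.List.Relation.Unary.Unique.Propositional using (Unique)
import Data.List.Relation.Unary.Unique.Propositional.Properties as Uniqueₚ
import Data.List.Relation.Unary.AllPairs as AllPairs
open import Data.Empty using (⊥-elim)
open import Data.Sum using (_⊎_; inj₁; inj₂)
open import Function using (_∘_; _$_)
open import Relation.Nullary using (¬_; yes; no)
open import Relation.Nullary.Decidable using (_×-dec_)
open import Relation.Binary.Definitions using (DecidableEquality; tri<; tri≈; tri>)
open import Relation.Unary using (Decidable)
open import Relation.Binary.PropositionalEquality

≢-via : ∀ {A : Set} {a b c d : A} → a ≡ c → b ≡ d → c ≢ d → a ≢ b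
≢-via a≡c b≡d c≢d a≡b = c≢d (trans (sym a≡c) (trans a≡b b≡d))

_≟_ : DecidableEquality Step
E ≟ E = yes refl
N ≟ N = yes refl
E ≟ N = no λ ()
N ≟ E = no λ ()

module _ {n : ℕ} where

  words-differ : ∀ {u v : Word n} i {a b} → lookup u i ≡ a → lookup v i ≡ b → a ≢ b → u ≢ v
  words-differ i p q a≢b refl = a≢b (trans (sym p) q)

  positions-differ : ∀ (w : Word n) {i j a b} → lookup w i ≡ a → lookup w j ≡ b → a ≢ b → i ≢ j
  positions-differ w p q a≢b refl = a≢b (trans (sym p) q)

≢⇒<⊎> : ∀ {n} {a b : Fin n} → a ≢ b → toℕ a < toℕ b ⊎ toℕ b < toℕ a
≢⇒<⊎> {a = a} {b} a≢b with Finₚ.<-cmp a b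
... | tri< a<b _ _ = inj₁ a<b
... | tri≈ _ a≡b _ = ⊥-elim (a≢b a≡b)
... | tri> _ _ b<a = inj₂ b<a

least : ∀ {n} {P : Fin n → Set} → Decidable P → ∀ {j} → P j →
  Σ (Fin n) λ x → P x × (∀ i → toℕ i < toℕ x → ¬ P i)
least {suc n} P? {j} pj with P? zero | j
... | yes p₀ | _     = zero , p₀ , λ _ ()
... | no ¬p₀ | zero  = ⊥-elim (¬p₀ pj)
... | no ¬p₀ | suc j with least (P? ∘ suc) pj
...   | x , px , min = suc x , px , λ { zero _ → ¬p₀ ; (suc i) (s≤s i<x) → min i i<x }

greatest : ∀ {n} {P : Fin n → Set} → Decidable P → ∀ {j} → P j →
  Σ (Fin n) λ x → P x × (∀ i → toℕ x < toℕ i → ¬ P i)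
greatest {suc n} P? {j} pj with Finₚ.any? (P? ∘ suc) | j
... | yes (i , pi) | _ with greatest (P? ∘ suc) pi
...   | x , px , max = suc x , px , λ { zero () ; (suc i) (s≤s x<i) → max i x<i }
greatest {suc n} P? pj | no none | zero  = zero , pj , λ { zero () ; (suc i) _ pi → none (i , pi) }
greatest {suc n} P? pj | no none | suc j = ⊥-elim (none (j , pj))

n+n≡2⇒n≡1 : ∀ k → k + k ≡ 2 → k ≡ 1
n+n≡2⇒n≡1 1 _ = refl
n+n≡2⇒n≡1 (suc (suc k)) eq = ⊥-elim (m+1+n≢0 k (suc-injective (suc-injective eq)))

module _ {A : Set} where

  0<length⇒∃∈ : ∀ {xs : List A} → 0 < length xs → ∃[ x ] x ∈ xs
  0<length⇒∃∈ {x ∷ _} _ = x , here refl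

  length≡1⇒∈-unique : ∀ {xs : List A} {x y} → length xs ≡ 1 → x ∈ xs → y ∈ xs → x ≡ y
  length≡1⇒∈-unique {_ ∷ []} _ (here refl) (here refl) = refl

  unique-map-on : ∀ {B : Set} {P : A → Set} (f : A → B) {xs} →
    (∀ {a b} → P a → P b → a ≢ b → f a ≢ f b) → All P xs → Unique xs → Unique (map f xs)
  unique-map-on f distinct [] AllPairs.[] = AllPairs.[]
  unique-map-on f distinct (pa ∷ ps) (a∉ AllPairs.∷ unique) =
    Allₚ.map⁺ (All.zipWith (λ (pb , a≢b) → distinct pa pb a≢b) (ps , a∉)) AllPairs.∷
    unique-map-on f distinct ps unique

exchange : ∀ {n} → Word n → Fin n → Fin n → Word n
exchange w x y = (w [ x ]≔ E) [ y ]≔ N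

module _ {n : ℕ} (w : Word n) {x y : Fin n} where

  lookup-exchange-source : x ≢ y → lookup (exchange w x y) x ≡ E
  lookup-exchange-source x≢y = trans (lookup∘update′ x≢y (w [ x ]≔ E) N) (lookup∘update x w E)

  lookup-exchange-target : lookup (exchange w x y) y ≡ N
  lookup-exchange-target = lookup∘update y (w [ x ]≔ E) N

  lookup-exchange-other : ∀ {j} → j ≢ x → j ≢ y → lookup (exchange w x y) j ≡ lookup w j
  lookup-exchange-other j≢x j≢y = trans (lookup∘update′ j≢y (w [ x ]≔ E) N) (lookup∘update′ j≢x w E)

prefN-length : ∀ {n} (w : Word n) → prefN n w ≡ countN w
prefN-length [] = refl
prefN-length (E ∷ w) = prefN-length w
prefN-length (N ∷ w) = cong suc (prefN-length w)

prefN-update-beyond : ∀ {n} k (w : Word n) i s → k ≤ toℕ i → prefN k (w [ i ]≔ s) ≡ prefN k w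
prefN-update-beyond zero w i s _ = refl
prefN-update-beyond (suc k) (E ∷ w) (suc i) s (s≤s k≤i) = prefN-update-beyond k w i s k≤i
prefN-update-beyond (suc k) (N ∷ w) (suc i) s (s≤s k≤i) = cong suc (prefN-update-beyond k w i s k≤i)

prefN-raise : ∀ {n} k (w : Word n) i → lookup w i ≡ E → toℕ i < k →
              prefN k (w [ i ]≔ N) ≡ suc (prefN k w)
prefN-raise (suc k) (E ∷ w) zero refl _ = refl
prefN-raise (suc k) (E ∷ w) (suc i) wi (s≤s i<k) = prefN-raise k w i wi i<k
prefN-raise (suc k) (N ∷ w) (suc i) wi (s≤s i<k) = cong suc (prefN-raise k w i wi i<k)

prefN-lower : ∀ {n} k (w : Word n) i → lookup w i ≡ N → toℕ i < k →
              suc (prefN k (w [ i ]≔ E)) ≡ prefN k w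
prefN-lower (suc k) (N ∷ w) zero refl _ = refl
prefN-lower (suc k) (E ∷ w) (suc i) wi (s≤s i<k) = prefN-lower k w i wi i<k
prefN-lower (suc k) (N ∷ w) (suc i) wi (s≤s i<k) = cong suc (prefN-lower k w i wi i<k)

prefN-lower-≤ : ∀ {n} k (w : Word n) i → prefN k (w [ i ]≔ E) ≤ prefN k w
prefN-lower-≤ zero w i = z≤n
prefN-lower-≤ (suc k) (E ∷ w) zero = ≤-refl
prefN-lower-≤ (suc k) (N ∷ w) zero = n≤1+n _
prefN-lower-≤ (suc k) (E ∷ w) (suc i) = prefN-lower-≤ k w i
prefN-lower-≤ (suc k) (N ∷ w) (suc i) = s≤s (prefN-lower-≤ k w i)

module _ {n : ℕ} (w : Word n) {x y : Fin n} (wx : lookup w x ≡ N) (wy : lookup w y ≡ E) where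

  private
    lowered-y : lookup (w [ x ]≔ E) y ≡ E
    lowered-y = trans (lookup∘update′ (positions-differ w wy wx λ ()) w E) wy

  prefN-exchange-before : ∀ k → k ≤ toℕ y → prefN k (exchange w x y) ≤ prefN k w
  prefN-exchange-before k k≤y =
    ≤-trans (≤-reflexive (prefN-update-beyond k (w [ x ]≔ E) y N k≤y)) (prefN-lower-≤ k w x)

  prefN-exchange-between : ∀ k → toℕ y < k → k ≤ toℕ x → prefN k (exchange w x y) ≡ suc (prefN k w)
  prefN-exchange-between k y<k k≤x =
    trans (prefN-raise k (w [ x ]≔ E) y lowered-y y<k) (cong suc (prefN-update-beyond k w x E k≤x))

  prefN-exchange-after : ∀ k → toℕ x < k → toℕ y < k → prefN k (exchange w x y) ≡ prefN k w
  prefN-exchange-after k x<k y<k =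
    trans (prefN-raise k (w [ x ]≔ E) y lowered-y y<k) (prefN-lower k w x wx x<k)

  countN-exchange : countN (exchange w x y) ≡ countN w
  countN-exchange = begin
    countN (exchange w x y)  ≡⟨ sym (prefN-length (exchange w x y)) ⟩
    prefN n (exchange w x y) ≡⟨ prefN-exchange-after n (Finₚ.toℕ<n x) (Finₚ.toℕ<n y) ⟩
    prefN n w                ≡⟨ prefN-length w ⟩
    countN w                 ∎
    where open ≡-Reasoning

  exchange-neverAbove : ∀ {Q} → NeverAbove w Q →
    (∀ k → toℕ y < k → k ≤ toℕ x → prefN k w < prefN k Q) → NeverAbove (exchange w x y) Q
  exchange-neverAbove w≤Q slack k with toℕ y <? k | toℕ x <? k
  ... | no y≮k  | _        = ≤-trans (prefN-exchange-before k (≮⇒≥ y≮k)) (w≤Q k)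
  ... | yes y<k | yes x<k  = ≤-trans (≤-reflexive (prefN-exchange-after k x<k y<k)) (w≤Q k)
  ... | yes y<k | no x≮k   =
    ≤-trans (≤-reflexive (prefN-exchange-between k y<k (≮⇒≥ x≮k))) (slack k y<k (≮⇒≥ x≮k))

prefN-emptyPrefix : ∀ {n} k (w : Word n) → (∀ j → toℕ j < k → lookup w j ≡ E) → prefN k w ≡ 0
prefN-emptyPrefix zero w _ = refl
prefN-emptyPrefix (suc k) [] _ = refl
prefN-emptyPrefix (suc k) (a ∷ w) empty with empty zero (s≤s z≤n)
... | refl = prefN-emptyPrefix k w λ j j<k → empty (suc j) (s≤s j<k)

prefN-fullSuffix : ∀ {n} k (w : Word n) → k ≤ n → (∀ j → k ≤ toℕ j → lookup w j ≡ N) →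
  prefN k w + (n ∸ k) ≡ countN w
prefN-fullSuffix zero [] _ _ = refl
prefN-fullSuffix zero (a ∷ w) _ full with full zero z≤n
... | refl = cong suc (prefN-fullSuffix zero w z≤n λ j _ → full (suc j) z≤n)
prefN-fullSuffix (suc k) (E ∷ w) (s≤s k≤n) full = prefN-fullSuffix k w k≤n λ j k≤j → full (suc j) (s≤s k≤j)
prefN-fullSuffix (suc k) (N ∷ w) (s≤s k≤n) full =
  cong suc (prefN-fullSuffix k w k≤n λ j k≤j → full (suc j) (s≤s k≤j))

prefN-positive : ∀ {n} (w : Word n) {j} k → lookup w j ≡ N → toℕ j < k → 0 < prefN k w
prefN-positive (N ∷ w) {zero}  (suc k) _  _          = s≤s z≤n
prefN-positive (N ∷ w) {suc j} (suc k) _  _          = s≤s z≤n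
prefN-positive (E ∷ w) {suc j} (suc k) wj (s≤s j<k) = prefN-positive w k wj j<k

countN≤length : ∀ {n} (w : Word n) → countN w ≤ n
countN≤length [] = z≤n
countN≤length (E ∷ w) = m≤n⇒m≤1+n (countN≤length w)
countN≤length (N ∷ w) = s≤s (countN≤length w)

countN<prefN+rest : ∀ {n} (w : Word n) {j} k → lookup w j ≡ E → k ≤ toℕ j →
  countN w < prefN k w + (n ∸ k)
countN<prefN+rest (E ∷ w)         zero    _  _          = s≤s (countN≤length w)
countN<prefN+rest (N ∷ w) {suc j} zero    wj _          = s≤s (countN<prefN+rest w zero wj z≤n)
countN<prefN+rest (E ∷ w) {suc j} (suc k) wj (s≤s k≤j) = countN<prefN+rest w k wj k≤j
countN<prefN+rest (N ∷ w) {suc j} (suc k) wj (s≤s k≤j) = s≤s (countN<prefN+rest w k wj k≤j)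

noLoop⇒prefN-positive : ∀ {m r Q} → NoLoop m r Q → ∀ k → 0 < k → k ≤ m + r → 0 < prefN k Q
noLoop⇒prefN-positive noLoop (suc k) _ k<n with noLoop (fromℕ< k<n)
... | B , (_ , B≤Q) , Bj =
  ≤-trans (prefN-positive B (suc k) Bj (s≤s (≤-reflexive (Finₚ.toℕ-fromℕ< k<n)))) (B≤Q (suc k))

noIsthmus⇒r<prefN+rest : ∀ {m r Q} → NoIsthmus m r Q → ∀ k → k < m + r → r < prefN k Q + (m + r ∸ k)
noIsthmus⇒r<prefN+rest {m} {r} {Q} noIsthmus k k<n with noIsthmus (fromℕ< k<n)
... | B , (countB , B≤Q) , Bk = begin-strict
  r                        ≡⟨ sym countB ⟩
  countN B                 <⟨ countN<prefN+rest B k Bk (≤-reflexive (sym (Finₚ.toℕ-fromℕ< k<n))) ⟩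
  prefN k B + (m + r ∸ k)  ≤⟨ +-monoˡ-≤ (m + r ∸ k) (B≤Q k) ⟩
  prefN k Q + (m + r ∸ k)  ∎
  where open ≤-Reasoning

exchange-isBasis : ∀ {m r Q} w {x y} → IsBasis m r Q w → lookup w x ≡ N → lookup w y ≡ E →
  (∀ k → toℕ y < k → k ≤ toℕ x → prefN k w < prefN k Q) → IsBasis m r Q (exchange w x y)
exchange-isBasis w (count , w≤Q) wx wy slack =
  trans (countN-exchange w wx wy) count , exchange-neverAbove w wx wy w≤Q slack

exchange-forward-isBasis : ∀ {m r Q} w {x y} → IsBasis m r Q w → lookup w x ≡ N → lookup w y ≡ E →
  toℕ x < toℕ y → IsBasis m r Q (exchange w x y)
exchange-forward-isBasis w basis wx wy x<y =
  exchange-isBasis w basis wx wy λ k y<k k≤x → ⊥-elim (<-asym x<y (<-≤-trans y<k k≤x))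

diffCount-sym : ∀ {n} (u v : Word n) → diffCount u v ≡ diffCount v u
diffCount-sym [] [] = refl
diffCount-sym (E ∷ u) (E ∷ v) = diffCount-sym u v
diffCount-sym (E ∷ u) (N ∷ v) = cong suc (diffCount-sym u v)
diffCount-sym (N ∷ u) (E ∷ v) = cong suc (diffCount-sym u v)
diffCount-sym (N ∷ u) (N ∷ v) = diffCount-sym u v

module _ {n : ℕ} where

  diffCount-∷-≡ : ∀ a (u v : Word n) → diffCount (a ∷ u) (a ∷ v) ≡ diffCount u v
  diffCount-∷-≡ E u v = refl
  diffCount-∷-≡ N u v = refl

  diffCount-∷-≢ : ∀ {a b} (u v : Word n) → a ≢ b → diffCount (a ∷ u) (b ∷ v) ≡ suc (diffCount u v)
  diffCount-∷-≢ {E} {E} u v a≢b = ⊥-elim (a≢b refl)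
  diffCount-∷-≢ {E} {N} u v a≢b = refl
  diffCount-∷-≢ {N} {E} u v a≢b = refl
  diffCount-∷-≢ {N} {N} u v a≢b = ⊥-elim (a≢b refl)

diffCount-zero : ∀ {n} (u v : Word n) → (∀ j → lookup u j ≡ lookup v j) → diffCount u v ≡ 0
diffCount-zero [] [] _ = refl
diffCount-zero (a ∷ u) (b ∷ v) agree with agree zero
... | refl = trans (diffCount-∷-≡ a u v) (diffCount-zero u v (agree ∘ suc))

diffCount-one : ∀ {n} (u v : Word n) i → lookup u i ≢ lookup v i →
  (∀ j → j ≢ i → lookup u j ≡ lookup v j) → diffCount u v ≡ 1
diffCount-one (a ∷ u) (b ∷ v) zero a≢b agree =
  trans (diffCount-∷-≢ u v a≢b) (cong suc (diffCount-zero u v λ j → agree (suc j) λ ()))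
diffCount-one (a ∷ u) (b ∷ v) (suc i) differ agree with agree zero (λ ())
... | refl = trans (diffCount-∷-≡ a u v)
                   (diffCount-one u v i differ λ j j≢i → agree (suc j) (j≢i ∘ Finₚ.suc-injective))

diffCount-two : ∀ {n} (u v : Word n) i j → i ≢ j → lookup u i ≢ lookup v i → lookup u j ≢ lookup v j →
  (∀ l → l ≢ i → l ≢ j → lookup u l ≡ lookup v l) → Adjacent u v
diffCount-two (a ∷ u) (b ∷ v) zero zero i≢j _ _ _ = ⊥-elim (i≢j refl)
diffCount-two (a ∷ u) (b ∷ v) zero (suc j) _ a≢b differ agree =
  trans (diffCount-∷-≢ u v a≢b) (cong suc (diffCount-one u v j differ λ l l≢j →
    agree (suc l) (λ ()) (l≢j ∘ Finₚ.suc-injective)))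
diffCount-two (a ∷ u) (b ∷ v) (suc i) zero _ differ a≢b agree =
  trans (diffCount-∷-≢ u v a≢b) (cong suc (diffCount-one u v i differ λ l l≢i →
    agree (suc l) (l≢i ∘ Finₚ.suc-injective) (λ ())))
diffCount-two (a ∷ u) (b ∷ v) (suc i) (suc j) i≢j differᵢ differⱼ agree with agree zero (λ ()) (λ ())
... | refl = trans (diffCount-∷-≡ a u v)
  (diffCount-two u v i j (i≢j ∘ cong suc) differᵢ differⱼ λ l l≢i l≢j →
    agree (suc l) (l≢i ∘ Finₚ.suc-injective) (l≢j ∘ Finₚ.suc-injective))

exchange-adjacent : ∀ {n} (w : Word n) {x y} → lookup w x ≡ N → lookup w y ≡ E →
  Adjacent w (exchange w x y)
exchange-adjacent w {x} {y} wx wy =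
  diffCount-two w (exchange w x y) x y x≢y
    (≢-via wx (lookup-exchange-source w x≢y) λ ())
    (≢-via wy (lookup-exchange-target w) λ ())
    λ l l≢x l≢y → sym (lookup-exchange-other w l≢x l≢y)
  where x≢y = positions-differ w wx wy λ ()

exchange-sources-differ : ∀ {n} (w : Word n) {x x′ z} → lookup w x ≡ N → lookup w x′ ≡ N →
  lookup w z ≡ E → x ≢ x′ → exchange w x z ≢ exchange w x′ z
exchange-sources-differ w {x} wx wx′ wz x≢x′ =
  words-differ x (lookup-exchange-source w (positions-differ w wx wz λ ()))
    (trans (lookup-exchange-other w x≢x′ (positions-differ w wx wz λ ())) wx) λ ()

exchange-targets-differ : ∀ {n} (w : Word n) {z y y′} → lookup w z ≡ N → lookup w y ≡ E →
  lookup w y′ ≡ E → y ≢ y′ → exchange w z y ≢ exchange w z y′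
exchange-targets-differ w {y = y} wz wy wy′ y≢y′ =
  words-differ y (lookup-exchange-target w)
    (trans (lookup-exchange-other w (positions-differ w wy wz λ ()) y≢y′) wy) λ ()

positions : ∀ {n} → Step → Step → Word n → Word n → List (Fin n)
positions s t [] [] = []
positions s t (a ∷ u) (b ∷ v) with (a ≟ s) ×-dec (b ≟ t)
... | yes _ = zero ∷ map suc (positions s t u v)
... | no _  = map suc (positions s t u v)

module _ (s t : Step) where

  ∈-positions⁺ : ∀ {n} (u v : Word n) {j} → lookup u j ≡ s → lookup v j ≡ t → j ∈ positions s t u v
  ∈-positions⁺ (a ∷ u) (b ∷ v) {j} us vt with (a ≟ s) ×-dec (b ≟ t) | j
  ... | yes _    | zero  = here refl
  ... | no ¬st   | zero  = ⊥-elim (¬st (us , vt))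
  ... | yes _    | suc j = there (∈-map⁺ suc (∈-positions⁺ u v us vt))
  ... | no _     | suc j = ∈-map⁺ suc (∈-positions⁺ u v us vt)

  ∈-positions⁻ : ∀ {n} (u v : Word n) {j} → j ∈ positions s t u v → lookup u j ≡ s × lookup v j ≡ t
  ∈-map-suc-positions⁻ : ∀ {n a b} (u v : Word n) {j} → j ∈ map suc (positions s t u v) →
                         lookup (a ∷ u) j ≡ s × lookup (b ∷ v) j ≡ t

  ∈-positions⁻ (a ∷ u) (b ∷ v) j∈ with (a ≟ s) ×-dec (b ≟ t) | j∈
  ... | yes st | here refl = st
  ... | yes _  | there j∈′ = ∈-map-suc-positions⁻ u v j∈′
  ... | no _   | j∈′       = ∈-map-suc-positions⁻ u v j∈′

  ∈-map-suc-positions⁻ u v j∈ with ∈-map⁻ suc j∈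
  ... | i , i∈ , refl = ∈-positions⁻ u v i∈

  positions-unique : ∀ {n} (u v : Word n) → Unique (positions s t u v)
  positions-unique [] [] = AllPairs.[]
  positions-unique (a ∷ u) (b ∷ v) with (a ≟ s) ×-dec (b ≟ t)
  ... | yes _ = Allₚ.map⁺ (All.universal (λ _ ()) _)
                AllPairs.∷ Uniqueₚ.map⁺ Finₚ.suc-injective (positions-unique u v)
  ... | no _  = Uniqueₚ.map⁺ Finₚ.suc-injective (positions-unique u v)

-- #[ s , t ] u v is the length of positions s t u v, counted directly so that the identities
-- below are plain recursions.
#[_,_] : ∀ {n} → Step → Step → Word n → Word n → ℕ
#[ s , t ] [] [] = 0
#[ s , t ] (a ∷ u) (b ∷ v) with (a ≟ s) ×-dec (b ≟ t)
... | yes _ = suc (#[ s , t ] u v)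
... | no _  = #[ s , t ] u v

length-positions : ∀ {n} s t (u v : Word n) → length (positions s t u v) ≡ #[ s , t ] u v
length-positions s t [] [] = refl
length-positions s t (a ∷ u) (b ∷ v) with (a ≟ s) ×-dec (b ≟ t)
... | yes _ = cong suc (trans (length-map suc (positions s t u v)) (length-positions s t u v))
... | no _  = trans (length-map suc (positions s t u v)) (length-positions s t u v)

#NN+#NE≡countN : ∀ {n} (u v : Word n) → #[ N , N ] u v + #[ N , E ] u v ≡ countN u
#NN+#NE≡countN [] [] = refl
#NN+#NE≡countN (N ∷ u) (N ∷ v) = cong suc (#NN+#NE≡countN u v)
#NN+#NE≡countN (N ∷ u) (E ∷ v) = trans (+-suc _ _) (cong suc (#NN+#NE≡countN u v))
#NN+#NE≡countN (E ∷ u) (N ∷ v) = #NN+#NE≡countN u v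
#NN+#NE≡countN (E ∷ u) (E ∷ v) = #NN+#NE≡countN u v

#NN+#EN≡countN : ∀ {n} (u v : Word n) → #[ N , N ] u v + #[ E , N ] u v ≡ countN v
#NN+#EN≡countN [] [] = refl
#NN+#EN≡countN (N ∷ u) (N ∷ v) = cong suc (#NN+#EN≡countN u v)
#NN+#EN≡countN (N ∷ u) (E ∷ v) = #NN+#EN≡countN u v
#NN+#EN≡countN (E ∷ u) (N ∷ v) = trans (+-suc _ _) (cong suc (#NN+#EN≡countN u v))
#NN+#EN≡countN (E ∷ u) (E ∷ v) = #NN+#EN≡countN u v

#NE+#EN≡diffCount : ∀ {n} (u v : Word n) → #[ N , E ] u v + #[ E , N ] u v ≡ diffCount u v
#NE+#EN≡diffCount [] [] = refl
#NE+#EN≡diffCount (N ∷ u) (N ∷ v) = #NE+#EN≡diffCount u v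
#NE+#EN≡diffCount (N ∷ u) (E ∷ v) = cong suc (#NE+#EN≡diffCount u v)
#NE+#EN≡diffCount (E ∷ u) (N ∷ v) = trans (+-suc _ _) (cong suc (#NE+#EN≡diffCount u v))
#NE+#EN≡diffCount (E ∷ u) (E ∷ v) = #NE+#EN≡diffCount u v

countN+#EN+#EE≡length : ∀ {n} (u v : Word n) → countN u + (#[ E , N ] u v + #[ E , E ] u v) ≡ n
countN+#EN+#EE≡length [] [] = refl
countN+#EN+#EE≡length (N ∷ u) (N ∷ v) = cong suc (countN+#EN+#EE≡length u v)
countN+#EN+#EE≡length (N ∷ u) (E ∷ v) = cong suc (countN+#EN+#EE≡length u v)
countN+#EN+#EE≡length (E ∷ u) (N ∷ v) = trans (+-suc _ _) (cong suc (countN+#EN+#EE≡length u v))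
countN+#EN+#EE≡length (E ∷ u) (E ∷ v) =
  trans (cong (countN u +_) (+-suc _ _)) (trans (+-suc _ _) (cong suc (countN+#EN+#EE≡length u v)))

module AdjacentBases {m r : ℕ} {Q B1 B2 : Word (m + r)}
  (basis₁ : IsBasis m r Q B1) (basis₂ : IsBasis m r Q B2) (adjacent : Adjacent B1 B2)
  {e : Fin (m + r)} (e₁ : lookup B1 e ≡ N) (e₂ : lookup B2 e ≡ E)
  -- Q starts with an N step, and takes an E step at or after every position.
  (Q-positive : ∀ k → 0 < k → k ≤ m + r → 0 < prefN k Q)
  (Q-room : ∀ k → k < m + r → r < prefN k Q + (m + r ∸ k))
  where

  n : ℕ
  n = m + r

  S T : Fin n → Set
  S j = lookup B1 j ≡ N × lookup B2 j ≡ N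
  T j = lookup B1 j ≡ E × lookup B2 j ≡ E

  #NN #NE #EN #EE : ℕ
  #NN = #[ N , N ] B1 B2
  #NE = #[ N , E ] B1 B2
  #EN = #[ E , N ] B1 B2
  #EE = #[ E , E ] B1 B2

  #NE≡#EN : #NE ≡ #EN
  #NE≡#EN = +-cancelˡ-≡ #NN _ _ (begin
    #NN + #NE  ≡⟨ #NN+#NE≡countN B1 B2 ⟩
    countN B1  ≡⟨ trans (proj₁ basis₁) (sym (proj₁ basis₂)) ⟩
    countN B2  ≡⟨ sym (#NN+#EN≡countN B1 B2) ⟩
    #NN + #EN  ∎)
    where open ≡-Reasoning

  #NE≡1 : #NE ≡ 1
  #NE≡1 = n+n≡2⇒n≡1 #NE (trans (cong (#NE +_) #NE≡#EN) (trans (#NE+#EN≡diffCount B1 B2) adjacent))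

  #EN≡1 : #EN ≡ 1
  #EN≡1 = trans (sym #NE≡#EN) #NE≡1

  #NN≡r∸1 : #NN ≡ r ∸ 1
  #NN≡r∸1 = begin
    #NN              ≡⟨ sym (m+n∸n≡m #NN 1) ⟩
    #NN + 1 ∸ 1      ≡⟨ cong (λ k → #NN + k ∸ 1) (sym #NE≡1) ⟩
    #NN + #NE ∸ 1    ≡⟨ cong (_∸ 1) (trans (#NN+#NE≡countN B1 B2) (proj₁ basis₁)) ⟩
    r ∸ 1            ∎
    where open ≡-Reasoning

  #EE≡m∸1 : #EE ≡ m ∸ 1
  #EE≡m∸1 = cong (_∸ 1) (+-cancelˡ-≡ r _ _ (begin
    r + suc #EE               ≡⟨ cong (λ k → r + (k + #EE)) (sym #EN≡1) ⟩
    r + (#EN + #EE)           ≡⟨ cong (_+ (#EN + #EE)) (sym (proj₁ basis₁)) ⟩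
    countN B1 + (#EN + #EE)   ≡⟨ countN+#EN+#EE≡length B1 B2 ⟩
    m + r                     ≡⟨ +-comm m r ⟩
    r + m                     ∎))
    where open ≡-Reasoning

  f-exists : ∃[ f ] f ∈ positions E N B1 B2
  f-exists = 0<length⇒∃∈ (≤-reflexive (sym (trans (length-positions E N B1 B2) #EN≡1)))

  f : Fin n
  f = proj₁ f-exists

  f₁ : lookup B1 f ≡ E
  f₁ = proj₁ (∈-positions⁻ E N B1 B2 (proj₂ f-exists))

  f₂ : lookup B2 f ≡ N
  f₂ = proj₂ (∈-positions⁻ E N B1 B2 (proj₂ f-exists))

  agree : ∀ j → j ≢ e → j ≢ f → lookup B1 j ≡ lookup B2 j
  agree j j≢e j≢f with lookup B1 j in p | lookup B2 j in q
  ... | E | E = refl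
  ... | N | N = refl
  ... | N | E = ⊥-elim (j≢e (length≡1⇒∈-unique (trans (length-positions N E B1 B2) #NE≡1)
                               (∈-positions⁺ N E B1 B2 p q) (∈-positions⁺ N E B1 B2 e₁ e₂)))
  ... | E | N = ⊥-elim (j≢f (length≡1⇒∈-unique (trans (length-positions E N B1 B2) #EN≡1)
                               (∈-positions⁺ E N B1 B2 p q) (proj₂ f-exists)))

  e≢f : e ≢ f
  e≢f = positions-differ B1 e₁ f₁ λ ()

  S⇒≢e : ∀ {x} → S x → x ≢ e
  S⇒≢e s = positions-differ B2 (proj₂ s) e₂ λ ()

  S⇒≢f : ∀ {x} → S x → x ≢ f
  S⇒≢f s = positions-differ B1 (proj₁ s) f₁ λ ()

  T⇒≢e : ∀ {y} → T y → y ≢ e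
  T⇒≢e t = positions-differ B1 (proj₁ t) e₁ λ ()

  T⇒≢f : ∀ {y} → T y → y ≢ f
  T⇒≢f t = positions-differ B2 (proj₂ t) f₂ λ ()

  S,T⇒≢ : ∀ {x y} → S x → T y → x ≢ y
  S,T⇒≢ s t = positions-differ B1 (proj₁ s) (proj₁ t) λ ()

  B1-E : ∀ j → j ≢ e → ¬ S j → lookup B1 j ≡ E
  B1-E j j≢e ¬s with lookup B1 j in p
  ... | E = refl
  ... | N = ⊥-elim (¬s (refl , trans (sym (agree j j≢e (positions-differ B1 p f₁ λ ()))) p))

  B2-E : ∀ j → j ≢ f → ¬ S j → lookup B2 j ≡ E
  B2-E j j≢f ¬s with lookup B2 j in q
  ... | E = refl
  ... | N = ⊥-elim (¬s (trans (agree j (positions-differ B2 q e₂ λ ()) j≢f) q , refl))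

  B1-N : ∀ j → j ≢ f → ¬ T j → lookup B1 j ≡ N
  B1-N j j≢f ¬t with lookup B1 j in p
  ... | N = refl
  ... | E = ⊥-elim (¬t (refl , trans (sym (agree j (positions-differ B1 p e₁ λ ()) j≢f)) p))

  B2-N : ∀ j → j ≢ e → ¬ T j → lookup B2 j ≡ N
  B2-N j j≢e ¬t with lookup B2 j in q
  ... | N = refl
  ... | E = ⊥-elim (¬t (trans (agree j j≢e (positions-differ B2 q f₂ λ ())) q , refl))

  Cycle : Set
  Cycle = Word n × Word n

  IsGoodCycle : Cycle → Set
  IsGoodCycle c = GoodCycle m r Q e B1 B2 (proj₁ c) (proj₂ c)

  goodCycle : ∀ {a b c d} → lookup B2 a ≡ N → lookup B2 b ≡ E → lookup B1 c ≡ N → lookup B1 d ≡ E →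
    b ≢ e → c ≢ e → Adjacent (exchange B2 a b) (exchange B1 c d) →
    IsBasis m r Q (exchange B2 a b) → IsBasis m r Q (exchange B1 c d) →
    IsGoodCycle (exchange B2 a b , exchange B1 c d)
  goodCycle {a} {b} {c} {d} a₂ b₂ c₁ d₁ b≢e c≢e adjacent₃₄ basis₃ basis₄ =
    basis₃ , basis₄
    , words-differ e e₁ B3e (λ ())
    , words-differ c c₁ (lookup-exchange-source B1 (positions-differ B1 c₁ d₁ λ ())) (λ ())
    , words-differ a a₂ (lookup-exchange-source B2 (positions-differ B2 a₂ b₂ λ ())) (λ ())
    , words-differ e e₂ B4e (λ ())
    , words-differ e B3e B4e (λ ())
    , exchange-adjacent B2 a₂ b₂
    , adjacent₃₄
    , trans (diffCount-sym (exchange B1 c d) B1) (exchange-adjacent B1 c₁ d₁)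
    , B4e , B3e
    where
    B3e : lookup (exchange B2 a b) e ≡ E
    B3e = trans (lookup-exchange-other B2 (positions-differ B2 e₂ a₂ λ ()) (≢-sym b≢e)) e₂
    B4e : lookup (exchange B1 c d) e ≡ N
    B4e = trans (lookup-exchange-other B1 (≢-sym c≢e) (positions-differ B1 e₁ d₁ λ ())) e₁

  module _ {x y : Fin n} (s : S x) (t : T y) where

    private
      x≢y = S,T⇒≢ s t
      e≢x = ≢-sym (S⇒≢e s)
      e≢y = ≢-sym (T⇒≢e t)
      f≢x = ≢-sym (S⇒≢f s)
      f≢y = ≢-sym (T⇒≢f t)

    goodCycle-xy-xy : IsBasis m r Q (exchange B2 x y) → IsBasis m r Q (exchange B1 x y) →
                      IsGoodCycle (exchange B2 x y , exchange B1 x y)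
    goodCycle-xy-xy = goodCycle (proj₂ s) (proj₂ t) (proj₁ s) (proj₁ t) (T⇒≢e t) (S⇒≢e s)
      (diffCount-two (exchange B2 x y) (exchange B1 x y) e f e≢f
        (≢-via (trans (lookup-exchange-other B2 e≢x e≢y) e₂)
               (trans (lookup-exchange-other B1 e≢x e≢y) e₁) λ ())
        (≢-via (trans (lookup-exchange-other B2 f≢x f≢y) f₂)
               (trans (lookup-exchange-other B1 f≢x f≢y) f₁) λ ())
        elsewhere)
      where
      elsewhere : ∀ l → l ≢ e → l ≢ f → lookup (exchange B2 x y) l ≡ lookup (exchange B1 x y) l
      elsewhere l l≢e l≢f with l Finₚ.≟ x | l Finₚ.≟ y
      ... | yes refl | _        = trans (lookup-exchange-source B2 x≢y) (sym (lookup-exchange-source B1 x≢y))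
      ... | no _     | yes refl = trans (lookup-exchange-target B2) (sym (lookup-exchange-target B1))
      ... | no l≢x   | no l≢y   = trans (lookup-exchange-other B2 l≢x l≢y)
                                 (trans (sym (agree l l≢e l≢f)) (sym (lookup-exchange-other B1 l≢x l≢y)))

    goodCycle-xy-xf : IsBasis m r Q (exchange B2 x y) → IsBasis m r Q (exchange B1 x f) →
                      IsGoodCycle (exchange B2 x y , exchange B1 x f)
    goodCycle-xy-xf = goodCycle (proj₂ s) (proj₂ t) (proj₁ s) f₁ (T⇒≢e t) (S⇒≢e s)
      (diffCount-two (exchange B2 x y) (exchange B1 x f) y e (T⇒≢e t)
        (≢-via (lookup-exchange-target B2)
               (trans (lookup-exchange-other B1 (≢-sym x≢y) (T⇒≢f t)) (proj₁ t)) λ ())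
        (≢-via (trans (lookup-exchange-other B2 e≢x e≢y) e₂)
               (trans (lookup-exchange-other B1 e≢x e≢f) e₁) λ ())
        elsewhere)
      where
      elsewhere : ∀ l → l ≢ y → l ≢ e → lookup (exchange B2 x y) l ≡ lookup (exchange B1 x f) l
      elsewhere l l≢y l≢e with l Finₚ.≟ x | l Finₚ.≟ f
      ... | yes refl | _        = trans (lookup-exchange-source B2 x≢y) (sym (lookup-exchange-source B1 (S⇒≢f s)))
      ... | no _     | yes refl = trans (lookup-exchange-other B2 f≢x l≢y)
                                 (trans f₂ (sym (lookup-exchange-target B1)))
      ... | no l≢x   | no l≢f   = trans (lookup-exchange-other B2 l≢x l≢y)
                                 (trans (sym (agree l l≢e l≢f)) (sym (lookup-exchange-other B1 l≢x l≢f)))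

    goodCycle-fy-xy : IsBasis m r Q (exchange B2 f y) → IsBasis m r Q (exchange B1 x y) →
                      IsGoodCycle (exchange B2 f y , exchange B1 x y)
    goodCycle-fy-xy = goodCycle f₂ (proj₂ t) (proj₁ s) (proj₁ t) (T⇒≢e t) (S⇒≢e s)
      (diffCount-two (exchange B2 f y) (exchange B1 x y) x e (S⇒≢e s)
        (≢-via (trans (lookup-exchange-other B2 (S⇒≢f s) x≢y) (proj₂ s)) (lookup-exchange-source B1 x≢y) λ ())
        (≢-via (trans (lookup-exchange-other B2 e≢f e≢y) e₂)
               (trans (lookup-exchange-other B1 e≢x e≢y) e₁) λ ())
        elsewhere)
      where
      elsewhere : ∀ l → l ≢ x → l ≢ e → lookup (exchange B2 f y) l ≡ lookup (exchange B1 x y) l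
      elsewhere l l≢x l≢e with l Finₚ.≟ y | l Finₚ.≟ f
      ... | yes refl | _        = trans (lookup-exchange-target B2) (sym (lookup-exchange-target B1))
      ... | no _     | yes refl = trans (lookup-exchange-source B2 f≢y)
                                 (trans (sym f₁) (sym (lookup-exchange-other B1 l≢x f≢y)))
      ... | no l≢y   | no l≢f   = trans (lookup-exchange-other B2 l≢f l≢y)
                                 (trans (sym (agree l l≢e l≢f)) (sym (lookup-exchange-other B1 l≢x l≢y)))

  GoodCycles : ℕ → Set
  GoodCycles ℓ = Σ (List Cycle) λ cs → Unique cs × ℓ ≤ length cs × All IsGoodCycle cs

  GoodCycles-weaken : ∀ {ℓ ℓ′} → ℓ′ ≤ ℓ → GoodCycles ℓ → GoodCycles ℓ′
  GoodCycles-weaken ℓ′≤ℓ (cs , unique , ℓ≤ , good) = cs , unique , ≤-trans ℓ′≤ℓ ℓ≤ , good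

  cycles-indexed-by-T : ∀ {z} → lookup B2 z ≡ N → (B4 : Fin n → Word n) →
    (∀ {y} → T y → IsGoodCycle (exchange B2 z y , B4 y)) → GoodCycles (m ∸ 1)
  cycles-indexed-by-T {z} z₂ B4 good =
    map cycle ys
    , unique-map-on cycle (λ t t′ y≢y′ → exchange-targets-differ B2 z₂ (proj₂ t) (proj₂ t′) y≢y′ ∘ cong proj₁)
        ys-T (positions-unique E E B1 B2)
    , ≤-reflexive (sym (trans (length-map cycle ys) (trans (length-positions E E B1 B2) #EE≡m∸1)))
    , Allₚ.map⁺ (All.map good ys-T)
    where
    ys = positions E E B1 B2
    ys-T : All T ys
    ys-T = All.tabulate (∈-positions⁻ E E B1 B2)
    cycle : Fin n → Cycle
    cycle y = exchange B2 z y , B4 y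

  cycles-indexed-by-S : ∀ {z} → lookup B1 z ≡ E → (B3 : Fin n → Word n) →
    (∀ {x} → S x → IsGoodCycle (B3 x , exchange B1 x z)) → GoodCycles (r ∸ 1)
  cycles-indexed-by-S {z} z₁ B3 good =
    map cycle xs
    , unique-map-on cycle (λ s s′ x≢x′ → exchange-sources-differ B1 (proj₁ s) (proj₁ s′) z₁ x≢x′ ∘ cong proj₂)
        xs-S (positions-unique N N B1 B2)
    , ≤-reflexive (sym (trans (length-map cycle xs) (trans (length-positions N N B1 B2) #NN≡r∸1)))
    , Allₚ.map⁺ (All.map good xs-S)
    where
    xs = positions N N B1 B2
    xs-S : All S xs
    xs-S = All.tabulate (∈-positions⁻ N N B1 B2)
    cycle : Fin n → Cycle
    cycle x = B3 x , exchange B1 x z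

  module Extremal {x₀ y₀ : Fin n} (s₀ : S x₀) (x₀-least : ∀ j → toℕ j < toℕ x₀ → ¬ S j)
                                  (t₀ : T y₀) (y₀-greatest : ∀ j → toℕ y₀ < toℕ j → ¬ T j) where

    module Side (w : Word n) (basis : IsBasis m r Q w) (a b : Fin n)
      (E-unless-S : ∀ j → j ≢ a → ¬ S j → lookup w j ≡ E)
      (N-unless-T : ∀ j → j ≢ b → ¬ T j → lookup w j ≡ N) where

      slack-initial : ∀ k → 0 < k → k ≤ toℕ x₀ → k ≤ toℕ a → prefN k w < prefN k Q
      slack-initial k 0<k k≤x₀ k≤a =
        subst (_< prefN k Q) (sym (prefN-emptyPrefix k w empty))
              (Q-positive k 0<k (<⇒≤ (≤-<-trans k≤x₀ (Finₚ.toℕ<n x₀))))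
        where
        empty : ∀ j → toℕ j < k → lookup w j ≡ E
        empty j j<k = E-unless-S j (Finₚ.<⇒≢ (<-≤-trans j<k k≤a)) (x₀-least j (<-≤-trans j<k k≤x₀))

      slack-final : ∀ k → k < n → toℕ y₀ < k → toℕ b < k → prefN k w < prefN k Q
      slack-final k k<n y₀<k b<k = +-cancelʳ-< (n ∸ k) (prefN k w) (prefN k Q) (begin-strict
        prefN k w + (n ∸ k)  ≡⟨ prefN-fullSuffix k w (<⇒≤ k<n) full ⟩
        countN w             ≡⟨ proj₁ basis ⟩
        r                    <⟨ Q-room k k<n ⟩
        prefN k Q + (n ∸ k)  ∎)
        where
        open ≤-Reasoning
        full : ∀ j → k ≤ toℕ j → lookup w j ≡ N
        full j k≤j = N-unless-T j (≢-sym (Finₚ.<⇒≢ (<-≤-trans b<k k≤j))) (y₀-greatest j (<-≤-trans y₀<k k≤j))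

      module _ {x y : Fin n} (wx : lookup w x ≡ N) (wy : lookup w y ≡ E) where

        exchange-initial : toℕ x ≤ toℕ x₀ → toℕ x ≤ toℕ a → IsBasis m r Q (exchange w x y)
        exchange-initial x≤x₀ x≤a = exchange-isBasis w basis wx wy λ k y<k k≤x →
          slack-initial k (≤-<-trans z≤n y<k) (≤-trans k≤x x≤x₀) (≤-trans k≤x x≤a)

        exchange-final : toℕ y₀ ≤ toℕ y → toℕ b ≤ toℕ y → IsBasis m r Q (exchange w x y)
        exchange-final y₀≤y b≤y = exchange-isBasis w basis wx wy λ k y<k k≤x →
          slack-final k (≤-<-trans k≤x (Finₚ.toℕ<n x)) (≤-<-trans y₀≤y y<k) (≤-<-trans b≤y y<k)

        exchange-anywhere : toℕ y₀ ≤ toℕ b → toℕ b ≤ toℕ a → toℕ a ≤ toℕ x₀ → IsBasis m r Q (exchange w x y)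
        exchange-anywhere y₀≤b b≤a a≤x₀ = exchange-isBasis w basis wx wy slack
          where
          slack : ∀ k → toℕ y < k → k ≤ toℕ x → prefN k w < prefN k Q
          slack k y<k k≤x with k ≤? toℕ a
          ... | yes k≤a = slack-initial k (≤-<-trans z≤n y<k) (≤-trans k≤a a≤x₀) k≤a
          ... | no k≰a  = slack-final k (≤-<-trans k≤x (Finₚ.toℕ<n x))
                            (≤-<-trans (≤-trans y₀≤b b≤a) (≰⇒> k≰a)) (≤-<-trans b≤a (≰⇒> k≰a))

    module Side₁ = Side B1 basis₁ e f B1-E B1-N
    module Side₂ = Side B2 basis₂ f e B2-E B2-N

    cycles-after-x₀ : toℕ e < toℕ x₀ → toℕ f < toℕ x₀ → GoodCycles (r ∸ 1)
    cycles-after-x₀ e<x₀ f<x₀ with ≢⇒<⊎> (T⇒≢e t₀) | ≢⇒<⊎> (T⇒≢f t₀)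
    ... | inj₂ e<y₀ | inj₂ f<y₀ = cycles-indexed-by-S (proj₁ t₀) (λ x → exchange B2 x y₀) λ s →
      goodCycle-xy-xy s t₀ (Side₂.exchange-final (proj₂ s) (proj₂ t₀) ≤-refl (<⇒≤ e<y₀))
                           (Side₁.exchange-final (proj₁ s) (proj₁ t₀) ≤-refl (<⇒≤ f<y₀))
    ... | inj₂ e<y₀ | inj₁ y₀<f = cycles-indexed-by-S f₁ (λ x → exchange B2 x y₀) λ s →
      goodCycle-xy-xf s t₀ (Side₂.exchange-final (proj₂ s) (proj₂ t₀) ≤-refl (<⇒≤ e<y₀))
                           (Side₁.exchange-final (proj₁ s) f₁ (<⇒≤ y₀<f) ≤-refl)
    ... | inj₁ y₀<e | inj₂ f<y₀ = cycles-indexed-by-S (proj₁ t₀) (λ _ → exchange B2 f y₀) λ s →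
      goodCycle-fy-xy s t₀ (exchange-forward-isBasis B2 basis₂ f₂ (proj₂ t₀) f<y₀)
                           (Side₁.exchange-final (proj₁ s) (proj₁ t₀) ≤-refl (<⇒≤ f<y₀))
    ... | inj₁ y₀<e | inj₁ y₀<f with ≢⇒<⊎> e≢f
    ...   | inj₂ f<e = cycles-indexed-by-S (proj₁ t₀) (λ _ → exchange B2 f y₀) λ s →
      goodCycle-fy-xy s t₀ (Side₂.exchange-initial f₂ (proj₂ t₀) (<⇒≤ f<x₀) ≤-refl)
                           (Side₁.exchange-anywhere (proj₁ s) (proj₁ t₀) (<⇒≤ y₀<f) (<⇒≤ f<e) (<⇒≤ e<x₀))
    ...   | inj₁ e<f = cycles-indexed-by-S f₁ (λ x → exchange B2 x y₀) λ s →
      goodCycle-xy-xf s t₀ (Side₂.exchange-anywhere (proj₂ s) (proj₂ t₀) (<⇒≤ y₀<e) (<⇒≤ e<f) (<⇒≤ f<x₀))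
                           (Side₁.exchange-final (proj₁ s) f₁ (<⇒≤ y₀<f) ≤-refl)

    goodCycles : GoodCycles ((r ∸ 1) ⊓ (m ∸ 1))
    goodCycles with ≢⇒<⊎> (S⇒≢e s₀) | ≢⇒<⊎> (S⇒≢f s₀)
    ... | inj₁ x₀<e | inj₁ x₀<f = GoodCycles-weaken (m⊓n≤n _ _) $
      cycles-indexed-by-T (proj₂ s₀) (exchange B1 x₀) λ t →
      goodCycle-xy-xy s₀ t (Side₂.exchange-initial (proj₂ s₀) (proj₂ t) ≤-refl (<⇒≤ x₀<f))
                           (Side₁.exchange-initial (proj₁ s₀) (proj₁ t) ≤-refl (<⇒≤ x₀<e))
    ... | inj₂ e<x₀ | inj₁ x₀<f = GoodCycles-weaken (m⊓n≤n _ _) $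
      cycles-indexed-by-T (proj₂ s₀) (λ _ → exchange B1 x₀ f) λ t →
      goodCycle-xy-xf s₀ t (Side₂.exchange-initial (proj₂ s₀) (proj₂ t) ≤-refl (<⇒≤ x₀<f))
                           (exchange-forward-isBasis B1 basis₁ (proj₁ s₀) f₁ x₀<f)
    ... | inj₁ x₀<e | inj₂ f<x₀ = GoodCycles-weaken (m⊓n≤n _ _) $
      cycles-indexed-by-T f₂ (exchange B1 x₀) λ t →
      goodCycle-fy-xy s₀ t (Side₂.exchange-initial f₂ (proj₂ t) (<⇒≤ f<x₀) ≤-refl)
                           (Side₁.exchange-initial (proj₁ s₀) (proj₁ t) ≤-refl (<⇒≤ x₀<e))
    ... | inj₂ e<x₀ | inj₂ f<x₀ = GoodCycles-weaken (m⊓n≤m _ _) (cycles-after-x₀ e<x₀ f<x₀)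

  goodCycles : 2 ≤ r → 2 ≤ m → GoodCycles ((r ∸ 1) ⊓ (m ∸ 1))
  goodCycles 2≤r 2≤m
    with 0<length⇒∃∈ (subst (0 <_) (sym (trans (length-positions N N B1 B2) #NN≡r∸1)) (m<n⇒0<n∸m 2≤r))
       | 0<length⇒∃∈ (subst (0 <_) (sym (trans (length-positions E E B1 B2) #EE≡m∸1)) (m<n⇒0<n∸m 2≤m))
  ... | _ , x∈ | _ , y∈
    with least (λ j → (lookup B1 j ≟ N) ×-dec (lookup B2 j ≟ N)) (∈-positions⁻ N N B1 B2 x∈)
       | greatest (λ j → (lookup B1 j ≟ E) ×-dec (lookup B2 j ≟ E)) (∈-positions⁻ E E B1 B2 y∈)
  ... | _ , s₀ , x₀-least | _ , t₀ , y₀-greatest = Extremal.goodCycles s₀ x₀-least t₀ y₀-greatest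

corollary3p2 : (m r : ℕ) → 2 ≤ r → 2 ≤ m
    → (Q : Word (m + r)) → IsPath m r Q
    → NoLoop m r Q → NoIsthmus m r Q
    → (B1 B2 : Word (m + r)) → IsBasis m r Q B1 → IsBasis m r Q B2
    → Adjacent B1 B2
    → (e : Fin (m + r)) → lookup B1 e ≡ N → lookup B2 e ≡ E
    → Σ (List (Word (m + r) × Word (m + r))) λ cs → (Unique cs × (r ∸ 1) ⊓ (m ∸ 1) ≤ length cs
        × All (λ c → GoodCycle m r Q e B1 B2 (proj₁ c) (proj₂ c)) cs)
corollary3p2 m r 2≤r 2≤m Q _ noLoop noIsthmus B1 B2 basis₁ basis₂ adjacent e e₁ e₂ =
  AdjacentBases.goodCycles basis₁ basis₂ adjacent e₁ e₂
    (noLoop⇒prefN-positive noLoop) (noIsthmus⇒r<prefN+rest noIsthmus) 2≤r 2≤m
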